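{- Let $T$ be a tree of order $n\geq 3$ with $p$ pendent edges. Then $$Sz_{n-1}(T)=n+p-1 \qquad\text{and}\qquad rSz_{n-1}(T)=2p+\frac{9}{4}(n-p-1).$$
   Context: A pendent edge is an edge incident to a vertex of degree $1$. For a connected graph $G$ and $S\subseteq V(G)$, the Steiner distance $d_G(S)$ is the minimum number of edges of a connected subgraph of $G$ whose vertex set contains $S$. For an edge $e=uv$ of $G$ and a positive integer $k$, define $N_u(e;k)=\{S'\subseteq V(G)\setminus\{u,v\} : |S'|=k-1,\ d_G(S'\cup\{u\})<d_G(S'\cup\{v\})\}$, $N_v(e;k)=\{S'\subseteq V(G)\setminus\{u,v\} : |S'|=k-1,\ d_G(S'\cup\{v\})<d_G(S'\cup\{u\})\}$, $N_0(e;k)=\{S'\subseteq V(G)\setminus\{u,v\} : |S'|=k-1,\ d_G(S'\cup\{u\})=d_G(S'\cup\{v\})\}$, with $n_u(e;k),n_v(e;k),n_0(e;k)$ their cardinalities. $Sz_k(G)=\sum_{e=uv\in E(G)}(n_u(e;k)+1)(n_v(e;k)+1)$ and $rSz_k(G)=\sum_{e=uv\in E(G)}(n_u(e;k)+n_0(e;k)/2+1)(n_v(e;k)+n_0(e;k)/2+1)$. -}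

module Defs where

open import Data.Bool using (Bool; true; false; _∧_; _∨_; not; if_then_else_)
open import Data.Nat using (ℕ; zero; suc; _+_; _*_; _∸_; _≤_; _<ᵇ_; _≡ᵇ_)
open import Data.Fin using (Fin; toℕ; _≟_)
open import Data.Fin.Subset using (Subset; ⁅_⁆; _∪_; ∣_∣)
open import Data.Vec using (Vec; lookup; []; _∷_)
open import Data.List using (List; []; _∷_; [_]; _++_; length; filter; map; foldr; concatMap; allFin)
open import Data.Bool.ListAction using (any; all)
open import Data.List.Relation.Unary.Unique.Propositional using (Unique)
open import Data.List.Relation.Unary.Linked using (Linked)
open import Data.Product using (_×_; _,_; Σ; ∃)
open import Data.Maybe using (Maybe; just; nothing)
open import Data.Integer using (+_)
open import Data.Rational using (ℚ; _/_; 0ℚ) renaming (_+_ to _+ℚ_; _*_ to _*ℚ_)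
open import Relation.Binary.PropositionalEquality using (_≡_)
open import Relation.Nullary using (¬_)
open import Relation.Nullary.Decidable using (⌊_⌋)

record Graph (n : ℕ) : Set where
  field
    adj    : Fin n → Fin n → Bool
    sym    : ∀ i j → adj i j ≡ adj j i
    irrefl : ∀ i → adj i i ≡ false
open Graph public

Adj : ∀ {n} → Graph n → Fin n → Fin n → Set
Adj G i j = adj G i j ≡ true

data Walk {n} (G : Graph n) : Fin n → Fin n → Set where
  here : ∀ {u} → Walk G u u
  step : ∀ {u v w} → Adj G u v → Walk G v w → Walk G u w

Connected : ∀ {n} → Graph n → Set
Connected G = ∀ u v → Walk G u v

HasCycle : ∀ {n} → Graph n → Set
HasCycle {n} G = Σ (Fin n) λ x → Σ (List (Fin n)) λ rest →
  (3 ≤ length (x ∷ rest)) × Unique (x ∷ rest) × Linked (Adj G) ((x ∷ rest) ++ [ x ])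

IsTree : ∀ {n} → Graph n → Set
IsTree G = Connected G × ¬ HasCycle G

-- edge list: each edge uv listed once as (u , v) with u < v
edges : ∀ {n} → Graph n → List (Fin n × Fin n)
edges {n} G = concatMap (λ i → map (λ j → (i , j))
                 (filter (λ j → Data.Bool.T? ((toℕ i <ᵇ toℕ j) ∧ adj G i j)) (allFin n)))
                (allFin n)
  where import Data.Bool

count : ∀ {A : Set} → (A → Bool) → List A → ℕ
count p xs = length (filter (λ x → Data.Bool.T? (p x)) xs)
  where import Data.Bool

degree : ∀ {n} → Graph n → Fin n → ℕ
degree {n} G v = count (adj G v) (allFin n)

pendent : ∀ {n} → Graph n → ℕ
pendent G = count (λ { (u , v) → (degree G u ≡ᵇ 1) ∨ (degree G v ≡ᵇ 1) }) (edges G)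

eqF : ∀ {n} → Fin n → Fin n → Bool
eqF i j = ⌊ i ≟ j ⌋

allSubsets : ∀ n → List (Subset n)
allSubsets zero    = [] ∷ []
allSubsets (suc n) = concatMap (λ s → (true ∷ s) ∷ (false ∷ s) ∷ []) (allSubsets n)

sublists : ∀ {A : Set} → List A → List (List A)
sublists []       = [] ∷ []
sublists (x ∷ xs) = concatMap (λ s → (x ∷ s) ∷ s ∷ []) (sublists xs)

iter : ∀ {A : Set} → ℕ → (A → A) → A → A
iter zero    f a = a
iter (suc k) f a = f (iter k f a)

reach : ∀ {n} → List (Fin n × Fin n) → Fin n → Fin n → Bool
reach {n} F u = iter n stepR (eqF u)
  where
  stepR : (Fin n → Bool) → Fin n → Bool
  stepR R y = R y ∨ any (λ { (a , b) → (R a ∧ eqF b y) ∨ (R b ∧ eqF a y) }) F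

-- (W , F) is a connected subgraph of G whose vertex set W contains S
-- (F ⊆ E(G) is guaranteed since F is a sublist of edges G)
validSub : ∀ {n} → Subset n → Subset n → List (Fin n × Fin n) → Bool
validSub {n} S W F =
  all (λ v → not (lookup S v) ∨ lookup W v) (allFin n)
  ∧ all (λ { (a , b) → lookup W a ∧ lookup W b }) F
  ∧ all (λ u → all (λ v → not (lookup W u) ∨ not (lookup W v) ∨ reach F u v) (allFin n)) (allFin n)

minList : List ℕ → Maybe ℕ
minList []       = nothing
minList (x ∷ xs) with minList xs
... | nothing = just x
... | just m  = just (Data.Nat._⊓_ x m)
  where import Data.Nat

-- d_G(S): minimum number of edges of a connected subgraph of G whose vertex
-- set contains S (for connected G such a subgraph always exists; the
-- default 0 is never used in that case)
steiner : ∀ {n} → Graph n → Subset n → ℕ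
steiner {n} G S with minList (concatMap (λ W →
                        map length (filter (λ F → Data.Bool.T? (validSub S W F)) (sublists (edges G))))
                      (allSubsets n))
  where import Data.Bool
... | just m  = m
... | nothing = 0

candidates : ∀ {n} → ℕ → Fin n → Fin n → List (Subset n)
candidates {n} k u v = filter (λ S → Data.Bool.T? ((∣ S ∣ ≡ᵇ (k ∸ 1)) ∧ not (lookup S u) ∧ not (lookup S v)))
                              (allSubsets n)
  where import Data.Bool

nU : ∀ {n} → Graph n → ℕ → Fin n → Fin n → ℕ
nU G k u v = count (λ S → steiner G (S ∪ ⁅ u ⁆) <ᵇ steiner G (S ∪ ⁅ v ⁆)) (candidates k u v)

nV : ∀ {n} → Graph n → ℕ → Fin n → Fin n → ℕ
nV G k u v = nU G k v u

n0 : ∀ {n} → Graph n → ℕ → Fin n → Fin n → ℕ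
n0 G k u v = count (λ S → steiner G (S ∪ ⁅ u ⁆) ≡ᵇ steiner G (S ∪ ⁅ v ⁆)) (candidates k u v)

Sz : ∀ {n} → ℕ → Graph n → ℕ
Sz k G = foldr _+_ 0 (map (λ { (u , v) → (nU G k u v + 1) * (nV G k u v + 1) }) (edges G))

ℕ→ℚ : ℕ → ℚ
ℕ→ℚ m = + m / 1

rSz : ∀ {n} → ℕ → Graph n → ℚ
rSz k G = foldr _+ℚ_ 0ℚ (map (λ { (u , v) →
    (ℕ→ℚ (nU G k u v) +ℚ (+ n0 G k u v / 2) +ℚ ℕ→ℚ 1)
    *ℚ (ℕ→ℚ (nV G k u v) +ℚ (+ n0 G k u v / 2) +ℚ ℕ→ℚ 1) }) (edges G))

-- For k = n − 1 the only admissible S′ for an edge uv is V ∖ {u, v}, so n_u, n_v and n_0 just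
-- compare d(V ∖ {v}) with d(V ∖ {u}). In a tree with n ≥ 3 vertices, d(V ∖ {w}) = n − 2 if w is a
-- leaf (drop the pendent edge at w) and n − 1 otherwise: a connected subgraph containing w spans the
-- tree, and one avoiding w misses the at least two edges at w, leaving at most n − 3 edges for
-- n − 1 vertices. No edge joins two leaves, so a pendent edge contributes (1 + 1)(0 + 1) = 2 to both
-- indices and every other edge contributes 1 to Sz and (1/2 + 1)² = 9/4 to rSz. Finally the tree has
-- n − 1 edges: sending each vertex other than a root to the edge through which a breadth-first search
-- first reaches it is injective, and every edge arises this way, since any other edge would close a
-- cycle with the search paths.

module Submission where

open import Defs hiding (sym)
open import Data.Bool using (Bool; true; false; T; T?; _∧_; _∨_; not; if_then_else_)
open import Data.Bool.ListAction using (any; all)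
open import Data.Bool.Properties using (T-≡; T-∧; T-∨)
open import Data.Empty using (⊥; ⊥-elim)
open import Data.Fin using (Fin; toℕ; fromℕ<; _≟_) renaming (zero to fzero; suc to fsuc)
open import Data.Fin.Properties using (injective⇒≤; toℕ-injective)
open import Data.Fin.Subset using (Subset; ⁅_⁆; _∪_; ∣_∣; ⊤; ∁)
  renaming (_∈_ to _∈ₛ_; _∉_ to _∉ₛ_; _⊆_ to _⊆ₛ_)
open import Data.Fin.Subset.Properties
  using (x∈⁅x⁆; x∈⁅y⁆⇒x≡y; ∣⁅x⁆∣≡1; ∣∁p∣≡n∸∣p∣; x∈∁p⇒x∉p; x∉p⇒x∈∁p; x∈p∪q⁻; x∈p∪q⁺; ∪-comm; ∪-identityʳ;
         ⊆-antisym; p⊂q⇒∣p∣<∣q∣; ∈⊤)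
  renaming (_∈?_ to _∈ₛ?_)
open import Data.Integer using (+_; _◃_) renaming (_+_ to _+ℤ_)
open import Data.Integer.Properties using (+◃n≡+n)
open import Data.List using (List; []; _∷_; [_]; _++_; length; filter; map; foldr; concatMap; allFin; lookup)
open import Data.List.Membership.Propositional using (_∈_; _∉_; lose; find)
open import Data.List.Membership.Propositional.Properties
  using (∈-lookup; ∈-allFin; ∈-filter⁺; ∈-filter⁻; ∈-map⁺; ∈-map⁻; ∈-concatMap⁺; ∈-concatMap⁻)
open import Data.List.Properties using (length-map; length-tabulate; filter-accept; filter-none)
open import Data.List.Relation.Binary.Sublist.Propositional using ([]; _∷_; _∷ʳ_) renaming (_⊆_ to _⊑_)
import Data.List.Relation.Binary.Sublist.Propositional as Sublist
import Data.List.Relation.Binary.Sublist.Propositional.Properties as Sublist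
open import Data.List.Relation.Binary.Subset.Propositional using (_⊆_)
open import Data.List.Relation.Unary.All as All using (All; []; _∷_; all?)
import Data.List.Relation.Unary.All.Properties as All
open import Data.List.Relation.Unary.All.Properties using (¬All⇒Any¬; ¬Any⇒All¬; all⁺; all⁻)
open import Data.List.Relation.Unary.Any as Any using (Any; here; there)
open import Data.List.Relation.Unary.Any.Properties using (lookup-index; any⁺; any⁻)
open import Data.List.Relation.Unary.Linked using (Linked; []; [-]; _∷_)
open import Data.List.Relation.Unary.Unique.Propositional using (Unique; []; _∷_)
import Data.List.Relation.Unary.Unique.Propositional.Properties as Unique
open import Data.Maybe using (just; nothing)
open import Data.Nat using (ℕ; zero; suc; _+_; _*_; _∸_; _⊓_; _≤_; _<_; _≤′_; ≤′-refl; ≤′-step; z≤n; s≤s; _<ᵇ_; _≡ᵇ_)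
open import Data.Nat.Coprimality using (1-coprimeTo) renaming (sym to coprime-sym)
open import Data.Nat.Properties
  using (≤-refl; ≤-reflexive; ≤-trans; ≤-antisym; ≤-total; _≤?_; ≰⇒>; <⇒≱; <-irrefl; <-asym; <-cmp; 1+n≰n;
         n<1+n; n≤1+n; ≤⇒≤′; <ᵇ⇒<; <⇒<ᵇ; ≡ᵇ⇒≡; ≡⇒≡ᵇ; +-suc; +-comm; +-identityʳ; *-identityʳ;
         ∸-monoʳ-≤; ∸-+-assoc; +-∸-comm; m+n∸m≡n; ⊓-sel; m⊓n≤m; m⊓n≤n; module ≤-Reasoning)
open import Data.Product using (_×_; _,_; proj₁; proj₂; Σ-syntax; ∃-syntax)
open import Data.Product.Properties using (≡-dec)
open import Data.Rational using (ℚ; _/_; _-_; 0ℚ; 1ℚ) renaming (_+_ to _+ℚ_; _*_ to _*ℚ_)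
open import Data.Rational.Properties using (normalize-coprime)
open import Data.Rational.Solver using (module +-*-Solver)
open import Data.Sign using () renaming (+ to pos)
open import Data.Sum using (_⊎_; inj₁; inj₂; [_,_]′)
open import Data.Vec using () renaming ([] to []ᵥ; _∷_ to _∷ᵥ_; here to hereᵥ; there to thereᵥ)
import Data.Vec as Vec
open import Data.Vec.Properties using (lookup⇒[]=; []=⇒lookup)
open import Function using (_∘_; _⇔_; Equivalence; mk⇔)
open import Relation.Binary using (DecidableEquality; tri<; tri≈; tri>)
open import Relation.Binary.Construct.Closure.ReflexiveTransitive as Star using (Star; ε; _◅_; _◅◅_)
open import Relation.Binary.PropositionalEquality
  using (_≡_; _≢_; refl; sym; trans; cong; cong₂; subst; module ≡-Reasoning)
open import Relation.Nullary using (¬_; ¬?; yes; no)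
open import Relation.Nullary.Decidable using (toWitness; fromWitness; _⊎-dec_)
open import Relation.Unary using (Decidable)
open import Relation.Unary.Properties using (∁?)

private
  variable
    A B : Set

T-implies⁻ : ∀ {x y} → T (not x ∨ y) → T x → T y
T-implies⁻ {true} t _ = t

T-implies⁺ : ∀ {x y} → (T x → T y) → T (not x ∨ y)
T-implies⁺ {true}  f = f _
T-implies⁺ {false} _ = _

T-not⁺ : ∀ {b} → ¬ T b → T (not b)
T-not⁺ {true}  ¬t = ¬t _
T-not⁺ {false} _  = _

T-not⁻ : ∀ {b} → T (not b) → ¬ T b
T-not⁻ {false} _ ()

indicator : Bool → ℕ
indicator b = if b then 1 else 0

∸1≡∸2+1 : ∀ m → 2 ≤ m → m ∸ 1 ≡ m ∸ 2 + 1
∸1≡∸2+1 (suc (suc m)) _ = +-comm 1 m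
∸1≡∸2+1 (suc zero) (s≤s ())

n∸2≰n∸3 : ∀ m → 3 ≤ m → ¬ (m ∸ 2 ≤ m ∸ 1 ∸ 2)
n∸2≰n∸3 (suc (suc (suc m))) _ = 1+n≰n
n∸2≰n∸3 (suc zero) (s≤s ())
n∸2≰n∸3 (suc (suc zero)) (s≤s (s≤s ()))

-- once ℕ→ℚ m is rewritten to its normal form mkℚ (+ m) 0 _, the sum computes
ℕ→ℚ-suc : ∀ m → ℕ→ℚ (suc m) ≡ ℕ→ℚ m +ℚ 1ℚ
ℕ→ℚ-suc m rewrite normalize-coprime (coprime-sym (1-coprimeTo m)) = cong (_/ 1) (sym numerator)
  where
  numerator : (pos ◃ (m * 1)) +ℤ + 1 ≡ + suc m
  numerator rewrite *-identityʳ m | +◃n≡+n m = cong +_ (+-comm m 1)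

ℕ→ℚ-∸1 : ∀ {m} q → 1 ≤ m → ℕ→ℚ (m ∸ 1) - q ≡ ℕ→ℚ m - q - ℕ→ℚ 1
ℕ→ℚ-∸1 {suc m} q _ rewrite ℕ→ℚ-suc m =
  solve 2 (λ x q → x :- q := (x :+ con 1ℚ) :- q :- con 1ℚ) refl (ℕ→ℚ m) q
  where open +-*-Solver

lookup-injective : {xs : List A} → Unique xs → ∀ {i j} → lookup xs i ≡ lookup xs j → i ≡ j
lookup-injective {xs = _ ∷ _}  _          {fzero}  {fzero}  _  = refl
lookup-injective {xs = _ ∷ _}  (x∉ ∷ _)   {fzero}  {fsuc j} eq = ⊥-elim (All.lookup x∉ (∈-lookup j) eq)
lookup-injective {xs = _ ∷ _}  (x∉ ∷ _)   {fsuc i} {fzero}  eq = ⊥-elim (All.lookup x∉ (∈-lookup i) (sym eq))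
lookup-injective {xs = _ ∷ _}  (_ ∷ uxs)  {fsuc i} {fsuc j} eq = cong fsuc (lookup-injective uxs eq)

length-mono-⊆ : {xs ys : List A} → Unique ys → ys ⊆ xs → length ys ≤ length xs
length-mono-⊆ {xs = xs} {ys} uys ys⊆xs = injective⇒≤ position-injective
  where
  position : Fin (length ys) → Fin (length xs)
  position i = Any.index (ys⊆xs (∈-lookup i))

  position-injective : ∀ {i j} → position i ≡ position j → i ≡ j
  position-injective {i} {j} eq = lookup-injective uys (begin
    lookup ys i                  ≡⟨ lookup-index (ys⊆xs (∈-lookup i)) ⟩
    lookup xs (position i)       ≡⟨ cong (lookup xs) eq ⟩
    lookup xs (position j)       ≡⟨ sym (lookup-index (ys⊆xs (∈-lookup j))) ⟩
    lookup ys j                  ∎)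
    where open ≡-Reasoning

map-unique : (f : A → B) {xs : List A} → Unique xs →
             (∀ {x y} → x ∈ xs → y ∈ xs → f x ≡ f y → x ≡ y) → Unique (map f xs)
map-unique f {[]} [] _ = []
map-unique f {x ∷ xs} (x∉ ∷ uxs) f-inj =
  All.map⁺ (All.tabulate λ {y} y∈xs fx≡fy → All.lookup x∉ y∈xs (f-inj (here refl) (there y∈xs) fx≡fy))
  ∷ map-unique f uxs λ x∈ y∈ → f-inj (there x∈) (there y∈)

concatMap-unique : (f : A → List B) (key : B → A) → (∀ {x y} → y ∈ f x → key y ≡ x) →
                   {xs : List A} → Unique xs → (∀ x → Unique (f x)) → Unique (concatMap f xs)
concatMap-unique f key key-f {[]} [] _ = []
concatMap-unique f key key-f {x ∷ xs} (x∉ ∷ uxs) uf =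
  Unique.++⁺ (uf x) (concatMap-unique f key key-f uxs uf) disjoint
  where
  disjoint : ∀ {y} → ¬ (y ∈ f x × y ∈ concatMap f xs)
  disjoint (y∈fx , y∈rest) with find (∈-concatMap⁻ f {xs = xs} y∈rest)
  ... | x′ , x′∈xs , y∈fx′ = All.lookup x∉ x′∈xs (trans (sym (key-f y∈fx)) (key-f y∈fx′))

length-filter-∁ : ∀ {P : A → Set} (P? : Decidable P) xs →
                  length (filter P? xs) + length (filter (∁? P?) xs) ≡ length xs
length-filter-∁ P? [] = refl
length-filter-∁ P? (x ∷ xs) with P? x
... | yes _ = cong suc (length-filter-∁ P? xs)
... | no  _ = trans (+-suc _ _) (cong suc (length-filter-∁ P? xs))

count-[_] : ∀ (p : A → Bool) x → count p [ x ] ≡ indicator (p x)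
count-[ p ] x with p x
... | true  = refl
... | false = refl

filter-≡[_] : ∀ {P : A → Set} (P? : Decidable P) {xs x} → Unique xs → x ∈ xs → P x →
              (∀ {y} → y ∈ xs → P y → y ≡ x) → filter P? xs ≡ [ x ]
filter-≡[ P? ] {_ ∷ zs} (z∉ ∷ _) (here refl) Px only =
  trans (filter-accept P? Px) (cong (_ ∷_) (filter-none P? (All.tabulate λ y∈zs Py →
    All.lookup z∉ y∈zs (sym (only (there y∈zs) Py)))))
filter-≡[ P? ] {z ∷ zs} (z∉ ∷ uzs) (there x∈zs) Px only with P? z
... | yes Pz = ⊥-elim (All.lookup z∉ x∈zs (only (here refl) Pz))
... | no  _  = filter-≡[ P? ] uzs x∈zs Px (only ∘ there)

length-allFin : ∀ n → length (allFin n) ≡ n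
length-allFin n = length-tabulate {n = n} (λ i → i)

module _ {n : ℕ} where
  open import Data.List.Membership.DecPropositional (_≟_ {n}) using (_∈?_)

  except : List (Fin n) → List (Fin n)
  except K = filter (∁? (_∈? K)) (allFin n)

  ∈-except⁺ : ∀ {K x} → x ∉ K → x ∈ except K
  ∈-except⁺ {x = x} x∉K = ∈-filter⁺ (∁? (_∈? _)) (∈-allFin x) x∉K

  ∈-except⁻ : ∀ {K x} → x ∈ except K → x ∉ K
  ∈-except⁻ {K} = proj₂ ∘ ∈-filter⁻ (∁? (_∈? K)) {xs = allFin n}

  except-unique : ∀ K → Unique (except K)
  except-unique K = Unique.filter⁺ (∁? (_∈? K)) (Unique.allFin⁺ n)

  length-except : ∀ {K} → Unique K → length (except K) ≡ n ∸ length K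
  length-except {K} uK = begin
    length (except K)                   ≡⟨ sym (m+n∸m≡n (length inside) _) ⟩
    length inside + length (except K) ∸ length inside
                                         ≡⟨ cong₂ _∸_ (length-filter-∁ (_∈? K) (allFin n)) length-inside ⟩
    length (allFin n) ∸ length K         ≡⟨ cong (_∸ length K) (length-allFin n) ⟩
    n ∸ length K                         ∎
    where
    open ≡-Reasoning
    inside = filter (_∈? K) (allFin n)
    length-inside : length inside ≡ length K
    length-inside = ≤-antisym
      (length-mono-⊆ (Unique.filter⁺ (_∈? K) (Unique.allFin⁺ n)) (proj₂ ∘ ∈-filter⁻ (_∈? K) {xs = allFin n}))
      (length-mono-⊆ uK (λ {x} x∈K → ∈-filter⁺ (_∈? K) (∈-allFin x) x∈K))

  fresh : ∀ {K} → length K < n → ∃[ x ] x ∉ K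
  fresh {K} K<n with all? (_∈? K) (allFin n)
  ... | yes all∈K = ⊥-elim (<⇒≱ K<n (subst (_≤ length K) (length-allFin n)
                      (length-mono-⊆ (Unique.allFin⁺ n) (All.lookup all∈K))))
  ... | no ¬all∈K = let (x , _ , x∉K) = find (¬All⇒Any¬ (_∈? K) (allFin n) ¬all∈K) in x , x∉K

Unique-⊑ : {xs ys : List A} → ys ⊑ xs → Unique xs → Unique ys
Unique-⊑ []         []          = []
Unique-⊑ (_ ∷ʳ τ)   (_ ∷ uxs)   = Unique-⊑ τ uxs
Unique-⊑ (refl ∷ τ) (x∉ ∷ uxs)  = Sublist.All-resp-⊆ τ x∉ ∷ Unique-⊑ τ uxs

⊑⇒⊆ : {xs ys : List A} → ys ⊑ xs → ys ⊆ xs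
⊑⇒⊆ τ = Sublist.lookup τ

∈-sublists⁺ : {xs ys : List A} → ys ⊑ xs → ys ∈ sublists xs
∈-sublists⁺ []         = here refl
∈-sublists⁺ {xs = x ∷ _} (_ ∷ʳ τ)   = ∈-concatMap⁺ (λ s → (x ∷ s) ∷ s ∷ []) (lose (∈-sublists⁺ τ) (there (here refl)))
∈-sublists⁺ {xs = x ∷ _} (refl ∷ τ) = ∈-concatMap⁺ (λ s → (x ∷ s) ∷ s ∷ []) (lose (∈-sublists⁺ τ) (here refl))

∈-sublists⁻ : (xs : List A) {ys : List A} → ys ∈ sublists xs → ys ⊑ xs
∈-sublists⁻ [] (here refl) = []
∈-sublists⁻ (x ∷ xs) ys∈ with find (∈-concatMap⁻ (λ s → (x ∷ s) ∷ s ∷ []) {xs = sublists xs} ys∈)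
... | _ , s∈ , here refl         = refl ∷ ∈-sublists⁻ xs s∈
... | _ , s∈ , there (here refl) = x ∷ʳ ∈-sublists⁻ xs s∈

∈-allSubsets : ∀ {n} (W : Subset n) → W ∈ allSubsets n
∈-allSubsets []ᵥ = here refl
∈-allSubsets {suc n} (b ∷ᵥ W) = ∈-concatMap⁺ (λ s → (true ∷ᵥ s) ∷ (false ∷ᵥ s) ∷ []) {xs = allSubsets n}
  (lose (∈-allSubsets W) (row b))
  where
  row : ∀ b → (b ∷ᵥ W) ∈ (true ∷ᵥ W) ∷ (false ∷ᵥ W) ∷ []
  row true  = here refl
  row false = there (here refl)

allSubsets-unique : ∀ n → Unique (allSubsets n)
allSubsets-unique zero    = [] ∷ []
allSubsets-unique (suc n) = concatMap-unique (λ s → (true ∷ᵥ s) ∷ (false ∷ᵥ s) ∷ []) Vec.tail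
  (λ { (here refl) → refl ; (there (here refl)) → refl })
  (allSubsets-unique n) (λ _ → ((λ ()) ∷ []) ∷ [] ∷ [])

minList-≢nothing : ∀ {xs : List ℕ} {x} → x ∈ xs → minList xs ≢ nothing
minList-≢nothing {y ∷ ys} _ eq with minList ys
minList-≢nothing {y ∷ ys} _ () | nothing
minList-≢nothing {y ∷ ys} _ () | just _

minList-just : ∀ xs {m} → minList xs ≡ just m → m ∈ xs × All (m ≤_) xs
minList-just (x ∷ xs) eq with minList xs in eq′
minList-just (x ∷ xs) refl | nothing with xs | eq′
... | [] | _ = here refl , ≤-refl ∷ []
... | y ∷ ys | eq″ = ⊥-elim (minList-≢nothing {y ∷ ys} (here refl) eq″)
minList-just (x ∷ xs) refl | just m′ with minList-just xs eq′
... | m′∈xs , m′≤xs = min∈ (⊓-sel x m′) , m⊓n≤m x m′ ∷ All.map (≤-trans (m⊓n≤n x m′)) m′≤xs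
  where
  min∈ : x ⊓ m′ ≡ x ⊎ x ⊓ m′ ≡ m′ → x ⊓ m′ ∈ x ∷ xs
  min∈ (inj₁ eq) = here eq
  min∈ (inj₂ eq) = there (subst (_∈ xs) (sym eq) m′∈xs)

vertices : ∀ {R : A → A → Set} {a b} → Star R a b → List A
vertices {a = a} ε       = [ a ]
vertices {a = a} (_ ◅ p) = a ∷ vertices p

steps : ∀ {R : A → A → Set} {a b} → Star R a b → ℕ
steps ε       = 0
steps (_ ◅ p) = suc (steps p)

length-vertices : ∀ {R : A → A → Set} {a b} (p : Star R a b) → length (vertices p) ≡ suc (steps p)
length-vertices ε       = refl
length-vertices (_ ◅ p) = cong suc (length-vertices p)

start∈vertices : ∀ {R : A → A → Set} {a b} (p : Star R a b) → a ∈ vertices p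
start∈vertices ε       = here refl
start∈vertices (_ ◅ _) = here refl

suffix : ∀ {R : A → A → Set} {a b x} (p : Star R a b) → x ∈ vertices p →
         Σ[ q ∈ Star R x b ] (Unique (vertices p) → Unique (vertices q))
suffix ε       (here refl) = ε , λ u → u
suffix (r ◅ p) (here refl) = r ◅ p , λ u → u
suffix (_ ◅ p) (there x∈p) with suffix p x∈p
... | q , uq = q , λ { (_ ∷ up) → uq up }

shortcut : ∀ {R : A → A → Set} → DecidableEquality A →
           ∀ {a b} → Star R a b → Σ[ q ∈ Star R a b ] Unique (vertices q)
shortcut _≟A_ ε = ε , [] ∷ []
shortcut _≟A_ {a = a} (r ◅ p) with shortcut _≟A_ p
... | q , uq with Any.any? (a ≟A_) (vertices q)
...   | yes a∈q = let (q′ , uq′) = suffix q a∈q in q′ , uq′ uq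
...   | no  a∉q = r ◅ q , ¬Any⇒All¬ (vertices q) a∉q ∷ uq

interior : ∀ {R : A → A → Set} {a b v} (p : Star R a b) → Unique (vertices p) → v ∈ vertices p → v ≢ a → v ≢ b →
           ∃[ c ] ∃[ d ] (c ≢ d × R c v × R v d)
interior ε _ (here refl) v≢a _ = ⊥-elim (v≢a refl)
interior (_ ◅ _) _ (here refl) v≢a _ = ⊥-elim (v≢a refl)
interior (_ ◅ ε) _ (there (here refl)) _ v≢b = ⊥-elim (v≢b refl)
interior (_ ◅ ε) _ (there (there ())) _ _
interior {a = a} (r ◅ r′ ◅ q) ((_ ∷ a∉q) ∷ _) (there (here refl)) _ _ =
  a , _ , All.lookup a∉q (start∈vertices q) , r , r′
interior (_ ◅ q@(_ ◅ _)) (_ ∷ uq@(w∉ ∷ _)) (there (there v∈)) _ v≢b =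
  interior q uq (there v∈) (λ v≡w → All.lookup w∉ v∈ (sym v≡w)) v≢b

linked-vertices : ∀ {R R′ : A → A → Set} → (∀ {x y} → R x y → R′ x y) →
                  ∀ {a b z} (p : Star R a b) → R′ b z → Linked R′ (vertices p ++ [ z ])
linked-vertices f ε               r′ = r′ ∷ [-]
linked-vertices f (r ◅ ε)         r′ = f r ∷ linked-vertices f ε r′
linked-vertices f (r ◅ q@(_ ◅ _)) r′ = f r ∷ linked-vertices f q r′

two-steps : ∀ {R : A → A → Set} {a b} (p : Star R a b) → a ≢ b → ¬ R a b → 2 ≤ steps p
two-steps ε           a≢b _  = ⊥-elim (a≢b refl)
two-steps (r ◅ ε)     _   ¬r = ⊥-elim (¬r r)
two-steps (_ ◅ _ ◅ _) _   _  = s≤s (s≤s z≤n)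

map-within : ∀ {R R′ : A → A → Set} {P : A → Set} → (∀ {x y} → P x → P y → R x y → R′ x y) →
             ∀ {a b} (p : Star R a b) → All P (vertices p) → Σ[ q ∈ Star R′ a b ] vertices q ≡ vertices p
map-within f ε       _          = ε , refl
map-within f (r ◅ p) (Pa ∷ Pp) with map-within f p Pp
... | q , eq = f Pa (All.lookup Pp (start∈vertices p)) r ◅ q , cong (_ ∷_) eq

-- Reachability along an edge list

Link : ∀ {n} → List (Fin n × Fin n) → Fin n → Fin n → Set
Link F a b = (a , b) ∈ F ⊎ (b , a) ∈ F

Link-sym : ∀ {n} {F : List (Fin n × Fin n)} {a b} → Link F a b → Link F b a
Link-sym (inj₁ ab∈F) = inj₂ ab∈F
Link-sym (inj₂ ba∈F) = inj₁ ba∈F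

Link-mono : ∀ {n} {F F′ : List (Fin n × Fin n)} → F ⊆ F′ → ∀ {a b} → Link F a b → Link F′ a b
Link-mono F⊆F′ (inj₁ ab∈F) = inj₁ (F⊆F′ ab∈F)
Link-mono F⊆F′ (inj₂ ba∈F) = inj₂ (F⊆F′ ba∈F)

module Reach {n : ℕ} (F : List (Fin n × Fin n)) where

  grow : (Fin n → Bool) → Fin n → Bool
  grow R y = R y ∨ any (λ { (a , b) → (R a ∧ eqF b y) ∨ (R b ∧ eqF a y) }) F

  -- the stages of the iteration defining reach, so that reach F u = reached u n
  reached : Fin n → ℕ → Fin n → Bool
  reached u k = iter k grow (eqF u)

  Enters : Fin n → ℕ → Fin n × Fin n → Fin n → Set
  Enters u k e y = (T (reached u k (proj₁ e)) × proj₂ e ≡ y) ⊎ (T (reached u k (proj₂ e)) × proj₁ e ≡ y)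

  reached-suc⁻ : ∀ u k y → T (reached u (suc k) y) → T (reached u k y) ⊎ ∃[ e ] (e ∈ F × Enters u k e y)
  reached-suc⁻ u k y r with Equivalence.to T-∨ r
  ... | inj₁ old = inj₁ old
  ... | inj₂ new with find (any⁻ _ F new)
  ... | (a , b) , e∈F , t with Equivalence.to T-∨ t
  ...   | inj₁ t₁ = let (ra , b≡y) = Equivalence.to T-∧ t₁ in inj₂ (_ , e∈F , inj₁ (ra , toWitness b≡y))
  ...   | inj₂ t₂ = let (rb , a≡y) = Equivalence.to T-∧ t₂ in inj₂ (_ , e∈F , inj₂ (rb , toWitness a≡y))

  reached-step : ∀ u k {a y} → T (reached u k a) → Link F a y → T (reached u (suc k) y)
  reached-step u k ra (inj₁ ay∈F) = Equivalence.from T-∨ (inj₂ (any⁺ _ (lose ay∈F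
    (Equivalence.from T-∨ (inj₁ (Equivalence.from T-∧ (ra , fromWitness refl)))))))
  reached-step u k ra (inj₂ ya∈F) = Equivalence.from T-∨ (inj₂ (any⁺ _ (lose ya∈F
    (Equivalence.from T-∨ (inj₂ (Equivalence.from T-∧ (ra , fromWitness refl)))))))

  reached-mono : ∀ u {k k′} y → k ≤ k′ → T (reached u k y) → T (reached u k′ y)
  reached-mono u {k} y k≤k′ r = go (≤⇒≤′ k≤k′)
    where
    go : ∀ {k′} → k ≤′ k′ → T (reached u k′ y)
    go ≤′-refl       = r
    go (≤′-step k≤′) = Equivalence.from T-∨ (inj₁ (go k≤′))

  reached⇒path : ∀ u k y → T (reached u k y) → Star (Link F) u y
  reached⇒path u zero y r with toWitness r
  ... | refl = ε
  reached⇒path u (suc k) y r with reached-suc⁻ u k y r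
  ... | inj₁ old = reached⇒path u k y old
  ... | inj₂ (_ , e∈F , inj₁ (ra , refl)) = reached⇒path u k _ ra ◅◅ inj₁ e∈F ◅ ε
  ... | inj₂ (_ , e∈F , inj₂ (rb , refl)) = reached⇒path u k _ rb ◅◅ inj₂ e∈F ◅ ε

  path⇒reached : ∀ u k {a y} (p : Star (Link F) a y) → T (reached u k a) → T (reached u (steps p + k) y)
  path⇒reached u k ε r = r
  path⇒reached u k {y = y} (l ◅ p) r = subst (λ j → T (reached u j y)) (+-suc (steps p) k)
    (path⇒reached u (suc k) p (reached-step u k r l))

  simple-path⇒reach : ∀ {u y} (p : Star (Link F) u y) → Unique (vertices p) → T (reach F u y)
  simple-path⇒reach {u} {y} p up = reached-mono u y steps≤n (path⇒reached u 0 p (fromWitness refl))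
    where
    steps≤n : steps p + 0 ≤ n
    steps≤n = begin
      steps p + 0              ≡⟨ +-identityʳ (steps p) ⟩
      steps p                  <⟨ n<1+n (steps p) ⟩
      suc (steps p)            ≡⟨ sym (length-vertices p) ⟩
      length (vertices p)      ≤⟨ length-mono-⊆ up (λ {x} _ → ∈-allFin x) ⟩
      length (allFin n)        ≡⟨ length-allFin n ⟩
      n                        ∎
      where open ≤-Reasoning

  reached⇒reach : ∀ u k y → T (reached u k y) → T (reach F u y)
  reached⇒reach u k y r = let (p , up) = shortcut _≟_ (reached⇒path u k y r) in simple-path⇒reach p up

  module Parents (u : Fin n) where

    FirstEntry : Fin n → Fin n × Fin n → ℕ → Set
    FirstEntry w e k = e ∈ F × ¬ T (reached u k w) × Enters u k e w

    first-entry : ∀ {w} → w ≢ u → T (reach F u w) → ∃[ k ] ∃[ e ] FirstEntry w e k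
    first-entry {w} w≢u = go n (λ r₀ → w≢u (sym (toWitness r₀)))
      where
      go : ∀ N → ¬ T (reached u 0 w) → T (reached u N w) → ∃[ k ] ∃[ e ] FirstEntry w e k
      go zero    new r = ⊥-elim (new r)
      go (suc N) new r with T? (reached u N w)
      ... | yes old = go N new old
      ... | no ¬old with reached-suc⁻ u N w r
      ...   | inj₁ old                = ⊥-elim (¬old old)
      ...   | inj₂ (e , e∈F , enters) = N , e , e∈F , ¬old , enters

    -- junk value (u , u) at the root and at unreachable vertices
    parent : Fin n → Fin n × Fin n
    parent w with w ≟ u | T? (reach F u w)
    ... | no w≢u | yes r = proj₁ (proj₂ (first-entry w≢u r))
    ... | _      | _     = u , u

    parent-first-entry : ∀ {w} → w ≢ u → T (reach F u w) → ∃[ k ] FirstEntry w (parent w) k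
    parent-first-entry {w} w≢u r with w ≟ u | T? (reach F u w)
    ... | yes w≡u | _      = ⊥-elim (w≢u w≡u)
    ... | no _    | no ¬r  = ⊥-elim (¬r r)
    ... | no w≢u′ | yes r′ = proj₁ (first-entry w≢u′ r′) , proj₂ (proj₂ (first-entry w≢u′ r′))

    crossing : ∀ a b k k′ → T (reached u k a) → ¬ T (reached u k b) →
               T (reached u k′ b) → ¬ T (reached u k′ a) → ⊥
    crossing a b k k′ ra ¬rb rb′ ¬ra′ with ≤-total k k′
    ... | inj₁ k≤k′ = ¬ra′ (reached-mono u a k≤k′ ra)
    ... | inj₂ k′≤k = ¬rb (reached-mono u b k′≤k rb′)

    first-entry-injective : ∀ {w w′ e k k′} → FirstEntry w e k → FirstEntry w′ e k′ → w ≡ w′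
    first-entry-injective (_ , _ , inj₁ (_ , refl)) (_ , _ , inj₁ (_ , refl)) = refl
    first-entry-injective (_ , _ , inj₂ (_ , refl)) (_ , _ , inj₂ (_ , refl)) = refl
    first-entry-injective {e = a , b} {k} {k′} (_ , ¬rb , inj₁ (ra , refl)) (_ , ¬ra′ , inj₂ (rb′ , refl)) =
      ⊥-elim (crossing a b k k′ ra ¬rb rb′ ¬ra′)
    first-entry-injective {e = a , b} {k} {k′} (_ , ¬ra , inj₂ (rb , refl)) (_ , ¬rb′ , inj₁ (ra′ , refl)) =
      ⊥-elim (crossing b a k k′ rb ¬ra ra′ ¬rb′)

    length≤length-edges : ∀ {L} → Unique L → (∀ {w} → w ∈ L → w ≢ u × T (reach F u w)) → length L ≤ length F
    length≤length-edges {L} uL reachable = begin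
      length L              ≡⟨ sym (length-map parent L) ⟩
      length (map parent L) ≤⟨ length-mono-⊆ (map-unique parent uL parent-injective) parent∈F ⟩
      length F              ∎
      where
      open ≤-Reasoning
      first-entry-of : ∀ {w} → w ∈ L → ∃[ k ] FirstEntry w (parent w) k
      first-entry-of w∈L = parent-first-entry (proj₁ (reachable w∈L)) (proj₂ (reachable w∈L))
      parent-injective : ∀ {x y} → x ∈ L → y ∈ L → parent x ≡ parent y → x ≡ y
      parent-injective {y = y} x∈L y∈L eq with first-entry-of x∈L | first-entry-of y∈L
      ... | k , x-entry | k′ , y-entry =
        first-entry-injective {k = k} {k′} x-entry (subst (λ e → FirstEntry y e k′) (sym eq) y-entry)
      parent∈F : map parent L ⊆ F
      parent∈F e∈ with ∈-map⁻ parent e∈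
      ... | w , w∈L , refl = proj₁ (proj₂ (first-entry-of w∈L))

    parents : List (Fin n × Fin n)
    parents = map parent (except [ u ])

    parent-path : ∀ k {x} → T (reached u k x) → Star (Link parents) u x
    parent-path zero r with toWitness r
    ... | refl = ε
    parent-path (suc k) {x} r with T? (reached u k x)
    ... | yes old = parent-path k old
    ... | no ¬old = extend (parent-first-entry x≢u (reached⇒reach u (suc k) x r))
      where
      x≢u : x ≢ u
      x≢u refl = ¬old (reached-mono u {0} {k} u z≤n (fromWitness refl))
      parent∈ : parent x ∈ parents
      parent∈ = ∈-map⁺ parent (∈-except⁺ λ { (here x≡u) → x≢u x≡u })
      extend : ∃[ k′ ] FirstEntry x (parent x) k′ → Star (Link parents) u x
      extend (k′ , _ , ¬r′ , enters) with k′ ≤? k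
      ... | no k′≰k = ⊥-elim (¬r′ (reached-mono u x (≰⇒> k′≰k) r))
      ... | yes k′≤k with enters
      ...   | inj₁ (ra , b≡x) = parent-path k (reached-mono u _ k′≤k ra)
                                  ◅◅ inj₁ (subst (λ z → (proj₁ (parent x) , z) ∈ parents) b≡x parent∈) ◅ ε
      ...   | inj₂ (rb , a≡x) = parent-path k (reached-mono u _ k′≤k rb)
                                  ◅◅ inj₂ (subst (λ z → (z , proj₂ (parent x)) ∈ parents) a≡x parent∈) ◅ ε

-- Steiner subgraphs

T-lookup⇔∈ : ∀ {n} {S : Subset n} {i} → T (Vec.lookup S i) ⇔ i ∈ₛ S
T-lookup⇔∈ {S = S} {i} = mk⇔ (λ t → lookup⇒[]= i S (Equivalence.to T-≡ t))
                             (λ i∈S → Equivalence.from T-≡ ([]=⇒lookup i∈S))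

record SteinerSubgraph {n} (S W : Subset n) (F : List (Fin n × Fin n)) : Set where
  field
    S⊆W         : S ⊆ₛ W
    F⊆W         : ∀ {a b} → (a , b) ∈ F → a ∈ₛ W × b ∈ₛ W
    W-connected : ∀ {x y} → x ∈ₛ W → y ∈ₛ W → T (reach F x y)

module _ {n} {S W : Subset n} {F : List (Fin n × Fin n)} where
  private
    to : ∀ {X : Subset n} {i} → T (Vec.lookup X i) → i ∈ₛ X
    to = Equivalence.to T-lookup⇔∈
    from : ∀ {X : Subset n} {i} → i ∈ₛ X → T (Vec.lookup X i)
    from = Equivalence.from T-lookup⇔∈

  validSub⇒ : T (validSub S W F) → SteinerSubgraph S W F
  validSub⇒ t = record { S⊆W = S⊆W ; F⊆W = F⊆W ; W-connected = W-connected }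
    where
    t₁ : T (all (λ v → not (Vec.lookup S v) ∨ Vec.lookup W v) (allFin n))
    t₁ = proj₁ (Equivalence.to T-∧ t)
    t₂₃ = proj₂ (Equivalence.to (T-∧ {all (λ v → not (Vec.lookup S v) ∨ Vec.lookup W v) (allFin n)}) t)
    t₂ : T (all (λ e → Vec.lookup W (proj₁ e) ∧ Vec.lookup W (proj₂ e)) F)
    t₂ = proj₁ (Equivalence.to T-∧ t₂₃)
    t₃ : T (all (λ x → all (λ y → not (Vec.lookup W x) ∨ not (Vec.lookup W y) ∨ reach F x y) (allFin n)) (allFin n))
    t₃ = proj₂ (Equivalence.to (T-∧ {all (λ e → Vec.lookup W (proj₁ e) ∧ Vec.lookup W (proj₂ e)) F}) t₂₃)
    S⊆W : S ⊆ₛ W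
    S⊆W {i} i∈S = to (T-implies⁻ (All.lookup (all⁺ _ (allFin n) t₁) (∈-allFin i)) (from i∈S))
    F⊆W : ∀ {a b} → (a , b) ∈ F → a ∈ₛ W × b ∈ₛ W
    F⊆W ab∈F = let (a∈W , b∈W) = Equivalence.to T-∧ (All.lookup (all⁺ _ F t₂) ab∈F) in to a∈W , to b∈W
    W-connected : ∀ {x y} → x ∈ₛ W → y ∈ₛ W → T (reach F x y)
    W-connected {x} {y} x∈W y∈W = T-implies⁻ (T-implies⁻
      (All.lookup (all⁺ _ (allFin n) (All.lookup (all⁺ _ (allFin n) t₃) (∈-allFin x))) (∈-allFin y))
      (from x∈W)) (from y∈W)

  ⇒validSub : SteinerSubgraph S W F → T (validSub S W F)
  ⇒validSub sub = Equivalence.from T-∧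
    ( all⁻ (λ v → not (Vec.lookup S v) ∨ Vec.lookup W v) {xs = allFin n}
        (All.tabulate λ _ → T-implies⁺ λ t → from (S⊆W (to t)))
    , Equivalence.from T-∧
      ( all⁻ (λ e → Vec.lookup W (proj₁ e) ∧ Vec.lookup W (proj₂ e)) {xs = F}
          (All.tabulate λ ab∈F → Equivalence.from T-∧ (from (proj₁ (F⊆W ab∈F)) , from (proj₂ (F⊆W ab∈F))))
      , all⁻ (λ x → all (λ y → not (Vec.lookup W x) ∨ not (Vec.lookup W y) ∨ reach F x y) (allFin n)) {xs = allFin n}
          (All.tabulate λ _ → all⁻ _ {xs = allFin n} (All.tabulate λ _ →
            T-implies⁺ λ tx → T-implies⁺ λ ty → W-connected (to tx) (to ty)))))
    where open SteinerSubgraph sub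

SteinerSubgraph-size : ∀ {n} {S W : Subset n} {F u L} → SteinerSubgraph S W F → u ∈ₛ W → Unique L →
                       (∀ {w} → w ∈ L → w ≢ u × w ∈ₛ W) → length L ≤ length F
SteinerSubgraph-size {F = F} {u} sub u∈W uL L⊆W =
  Reach.Parents.length≤length-edges F u uL λ w∈L → proj₁ (L⊆W w∈L) , W-connected u∈W (proj₂ (L⊆W w∈L))
  where open SteinerSubgraph sub

-- The (n − 2)-subsets avoiding two vertices

∣p∪⁅x⁆∣≡1+∣p∣ : ∀ {n} (p : Subset n) x → x ∉ₛ p → ∣ p ∪ ⁅ x ⁆ ∣ ≡ suc ∣ p ∣
∣p∪⁅x⁆∣≡1+∣p∣ (false ∷ᵥ p) fzero    _  = cong (suc ∘ ∣_∣) (∪-identityʳ p)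
∣p∪⁅x⁆∣≡1+∣p∣ (true  ∷ᵥ p) fzero    x∉ = ⊥-elim (x∉ hereᵥ)
∣p∪⁅x⁆∣≡1+∣p∣ (false ∷ᵥ p) (fsuc x) x∉ = ∣p∪⁅x⁆∣≡1+∣p∣ p x (x∉ ∘ thereᵥ)
∣p∪⁅x⁆∣≡1+∣p∣ (true  ∷ᵥ p) (fsuc x) x∉ = cong suc (∣p∪⁅x⁆∣≡1+∣p∣ p x (x∉ ∘ thereᵥ))

⊆-∣∣-antisym : ∀ {n} {p q : Subset n} → p ⊆ₛ q → ∣ p ∣ ≡ ∣ q ∣ → p ≡ q
⊆-∣∣-antisym {p = p} {q} p⊆q ∣p∣≡∣q∣ = ⊆-antisym p⊆q q⊆p
  where
  q⊆p : q ⊆ₛ p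
  q⊆p {x} x∈q with x ∈ₛ? p
  ... | yes x∈p = x∈p
  ... | no  x∉p = ⊥-elim (<-irrefl ∣p∣≡∣q∣ (p⊂q⇒∣p∣<∣q∣ (p⊆q , x , x∈q , x∉p)))

module _ {n : ℕ} where

  ∈-∁⁅⁆ : ∀ {i v : Fin n} → i ≢ v → i ∈ₛ ∁ ⁅ v ⁆
  ∈-∁⁅⁆ {v = v} i≢v = x∉p⇒x∈∁p (i≢v ∘ x∈⁅y⁆⇒x≡y v)

  ∈-∁⁅⁆⁻ : ∀ {i v : Fin n} → i ∈ₛ ∁ ⁅ v ⁆ → i ≢ v
  ∈-∁⁅⁆⁻ {v = v} i∈ refl = x∈∁p⇒x∉p i∈ (x∈⁅x⁆ v)

  without : Fin n → Fin n → Subset n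
  without u v = ∁ (⁅ u ⁆ ∪ ⁅ v ⁆)

  ∈-without : ∀ {i u v} → i ≢ u → i ≢ v → i ∈ₛ without u v
  ∈-without {u = u} {v} i≢u i≢v = x∉p⇒x∈∁p λ i∈ → [ i≢u ∘ x∈⁅y⁆⇒x≡y u , i≢v ∘ x∈⁅y⁆⇒x≡y v ]′ (x∈p∪q⁻ _ _ i∈)

  ∈-without⁻ : ∀ {i u v} → i ∈ₛ without u v → i ≢ u × i ≢ v
  ∈-without⁻ {u = u} {v} i∈ = (λ { refl → x∈∁p⇒x∉p i∈ (x∈p∪q⁺ (inj₁ (x∈⁅x⁆ u))) })
                            , (λ { refl → x∈∁p⇒x∉p i∈ (x∈p∪q⁺ (inj₂ (x∈⁅x⁆ v))) })

  without-comm : ∀ u v → without u v ≡ without v u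
  without-comm u v = cong ∁ (∪-comm ⁅ u ⁆ ⁅ v ⁆)

  without∪⁅⁆ : ∀ {u v} → u ≢ v → without u v ∪ ⁅ u ⁆ ≡ ∁ ⁅ v ⁆
  without∪⁅⁆ {u} {v} u≢v = ⊆-antisym ⊆∁⁅v⁆ ∁⁅v⁆⊆
    where
    ⊆∁⁅v⁆ : without u v ∪ ⁅ u ⁆ ⊆ₛ ∁ ⁅ v ⁆
    ⊆∁⁅v⁆ i∈ with x∈p∪q⁻ _ _ i∈
    ... | inj₁ i∈without = ∈-∁⁅⁆ (proj₂ (∈-without⁻ i∈without))
    ... | inj₂ i∈⁅u⁆ rewrite x∈⁅y⁆⇒x≡y u i∈⁅u⁆ = ∈-∁⁅⁆ u≢v
    ∁⁅v⁆⊆ : ∁ ⁅ v ⁆ ⊆ₛ without u v ∪ ⁅ u ⁆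
    ∁⁅v⁆⊆ {i} i∈ with i ≟ u
    ... | yes refl = x∈p∪q⁺ (inj₂ (x∈⁅x⁆ u))
    ... | no  i≢u  = x∈p∪q⁺ (inj₁ (∈-without i≢u (∈-∁⁅⁆⁻ i∈)))

  ∣without∣ : ∀ {u v} → u ≢ v → ∣ without u v ∣ ≡ n ∸ 2
  ∣without∣ {u} {v} u≢v = begin
    ∣ without u v ∣            ≡⟨ ∣∁p∣≡n∸∣p∣ (⁅ u ⁆ ∪ ⁅ v ⁆) ⟩
    n ∸ ∣ ⁅ u ⁆ ∪ ⁅ v ⁆ ∣      ≡⟨ cong (n ∸_) (∣p∪⁅x⁆∣≡1+∣p∣ ⁅ u ⁆ v (u≢v ∘ sym ∘ x∈⁅y⁆⇒x≡y u)) ⟩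
    n ∸ suc ∣ ⁅ u ⁆ ∣          ≡⟨ cong (λ k → n ∸ suc k) (∣⁅x⁆∣≡1 u) ⟩
    n ∸ 2                      ∎
    where open ≡-Reasoning

  candidates-n∸1 : ∀ {u v} → u ≢ v → candidates (n ∸ 1) u v ≡ [ without u v ]
  candidates-n∸1 {u} {v} u≢v = filter-≡[ (λ S → T? (candidate S)) ] (allSubsets-unique n)
    (∈-allSubsets (without u v)) is-candidate only
    where
    candidate : Subset n → Bool
    candidate S = (∣ S ∣ ≡ᵇ (n ∸ 1 ∸ 1)) ∧ not (Vec.lookup S u) ∧ not (Vec.lookup S v)
    T-not-lookup : ∀ {S i} → i ∉ₛ S → T (not (Vec.lookup S i))
    T-not-lookup i∉S = T-not⁺ (i∉S ∘ Equivalence.to T-lookup⇔∈)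
    is-candidate : T (candidate (without u v))
    is-candidate = Equivalence.from T-∧
      ( ≡⇒≡ᵇ _ _ (trans (∣without∣ u≢v) (sym (∸-+-assoc n 1 1)))
      , Equivalence.from T-∧ ( T-not-lookup {without u v} (λ u∈ → proj₁ (∈-without⁻ u∈) refl)
                             , T-not-lookup {without u v} (λ v∈ → proj₂ (∈-without⁻ v∈) refl)))
    only : ∀ {S} → S ∈ allSubsets n → T (candidate S) → S ≡ without u v
    only {S} _ t with Equivalence.to (T-∧ {∣ S ∣ ≡ᵇ (n ∸ 1 ∸ 1)}) t
    ... | ∣S∣ , t′ with Equivalence.to (T-∧ {not (Vec.lookup S u)}) t′
    ... | u∉S , v∉S = ⊆-∣∣-antisym S⊆without
          (trans (≡ᵇ⇒≡ _ _ ∣S∣) (trans (∸-+-assoc n 1 1) (sym (∣without∣ u≢v))))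
      where
      S⊆without : S ⊆ₛ without u v
      S⊆without i∈S = ∈-without (λ { refl → T-not⁻ u∉S (Equivalence.from T-lookup⇔∈ i∈S) })
                                (λ { refl → T-not⁻ v∉S (Equivalence.from T-lookup⇔∈ i∈S) })

_≟ₑ_ : ∀ {n} → DecidableEquality (Fin n × Fin n)
_≟ₑ_ = ≡-dec _≟_ _≟_

module GraphProperties {n : ℕ} (G : Graph n) where

  Adj-sym : ∀ {a b} → Adj G a b → Adj G b a
  Adj-sym {a} {b} r = trans (Graph.sym G b a) r

  Adj⇒≢ : ∀ {a b} → Adj G a b → a ≢ b
  Adj⇒≢ {a} r refl with trans (sym r) (irrefl G a)
  ... | ()

  forward : Fin n → List (Fin n)
  forward i = filter (λ j → T? ((toℕ i <ᵇ toℕ j) ∧ adj G i j)) (allFin n)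

  ∈-edges⁻ : ∀ {a b} → (a , b) ∈ edges G → toℕ a < toℕ b × Adj G a b
  ∈-edges⁻ ab∈E with find (∈-concatMap⁻ (λ i → map (i ,_) (forward i)) {xs = allFin n} ab∈E)
  ... | i , _ , ab∈row with ∈-map⁻ (i ,_) ab∈row
  ... | j , j∈ , refl with Equivalence.to T-∧ (proj₂ (∈-filter⁻ (λ j → T? _) {xs = allFin n} j∈))
  ... | i<j , r = <ᵇ⇒< (toℕ i) (toℕ j) i<j , Equivalence.to T-≡ r

  ∈-edges⁺ : ∀ {a b} → toℕ a < toℕ b → Adj G a b → (a , b) ∈ edges G
  ∈-edges⁺ {a} {b} a<b r = ∈-concatMap⁺ (λ i → map (i ,_) (forward i)) {xs = allFin n}
    (lose (∈-allFin a) (∈-map⁺ (a ,_) (∈-filter⁺ (λ j → T? _) (∈-allFin b)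
      (Equivalence.from T-∧ (<⇒<ᵇ a<b , Equivalence.from T-≡ r)))))

  edges-unique : Unique (edges G)
  edges-unique = concatMap-unique (λ i → map (i ,_) (forward i)) proj₁ first (Unique.allFin⁺ n)
    (λ i → Unique.map⁺ (cong proj₂) (Unique.filter⁺ (λ j → T? _) (Unique.allFin⁺ n)))
    where
    first : ∀ {i e} → e ∈ map (i ,_) (forward i) → proj₁ e ≡ i
    first {i} e∈ with ∈-map⁻ (i ,_) e∈
    ... | _ , _ , refl = refl

  Adj⇒Link : ∀ {a b} → Adj G a b → Link (edges G) a b
  Adj⇒Link {a} {b} r with <-cmp (toℕ a) (toℕ b)
  ... | tri< a<b _ _ = inj₁ (∈-edges⁺ a<b r)
  ... | tri≈ _ a≡b _ = ⊥-elim (Adj⇒≢ r (toℕ-injective a≡b))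
  ... | tri> _ _ b<a = inj₂ (∈-edges⁺ b<a (Adj-sym r))

  Link⇒Adj : ∀ {a b} → Link (edges G) a b → Adj G a b
  Link⇒Adj (inj₁ ab∈E) = proj₂ (∈-edges⁻ ab∈E)
  Link⇒Adj (inj₂ ba∈E) = Adj-sym (proj₂ (∈-edges⁻ ba∈E))

  neighbours : Fin n → List (Fin n)
  neighbours v = filter (λ x → T? (adj G v x)) (allFin n)

  ∈-neighbours : ∀ {v a} → Adj G v a → a ∈ neighbours v
  ∈-neighbours {v} {a} r = ∈-filter⁺ (λ x → T? (adj G v x)) (∈-allFin a) (Equivalence.from T-≡ r)

  neighbours-unique : ∀ v → Unique (neighbours v)
  neighbours-unique v = Unique.filter⁺ (λ x → T? (adj G v x)) (Unique.allFin⁺ n)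

  degree-≥1 : ∀ {v a} → Adj G v a → 1 ≤ degree G v
  degree-≥1 {v} r = length-mono-⊆ ([] ∷ []) λ { (here refl) → ∈-neighbours r }

  degree-≥2 : ∀ {v a b} → a ≢ b → Adj G v a → Adj G v b → 2 ≤ degree G v
  degree-≥2 {v} a≢b ra rb = length-mono-⊆ ((a≢b ∷ []) ∷ [] ∷ [])
    λ { (here refl) → ∈-neighbours ra ; (there (here refl)) → ∈-neighbours rb }

  -- the list whose minimum defines steiner G S
  costs : Subset n → List ℕ
  costs S = concatMap (λ W → map length (filter (λ F → T? (validSub S W F)) (sublists (edges G))))
                      (allSubsets n)

  ∈-costs⁺ : ∀ {S W F} → F ⊑ edges G → SteinerSubgraph S W F → length F ∈ costs S
  ∈-costs⁺ {S} {W} F⊑E sub = ∈-concatMap⁺ _ {xs = allSubsets n} (lose (∈-allSubsets W)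
    (∈-map⁺ length (∈-filter⁺ (λ F → T? (validSub S W F)) (∈-sublists⁺ F⊑E) (⇒validSub sub))))

  ∈-costs⁻ : ∀ {S c} → c ∈ costs S → ∃[ W ] ∃[ F ] (F ⊑ edges G × SteinerSubgraph S W F × c ≡ length F)
  ∈-costs⁻ {S} c∈ with find (∈-concatMap⁻ _ {xs = allSubsets n} c∈)
  ... | W , _ , c∈row with ∈-map⁻ length c∈row
  ... | F , F∈ , refl with ∈-filter⁻ (λ F → T? (validSub S W F)) {xs = sublists (edges G)} F∈
  ... | F∈sublists , valid = W , F , ∈-sublists⁻ (edges G) F∈sublists , validSub⇒ valid , refl

  steiner-≡ : ∀ {S m} → (∀ {W F} → F ⊑ edges G → SteinerSubgraph S W F → m ≤ length F) →
              ∃[ W ] ∃[ F ] (F ⊑ edges G × SteinerSubgraph S W F × length F ≤ m) → steiner G S ≡ m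
  steiner-≡ {S} lower (W , F , F⊑E , sub , F≤m) with minList (costs S) in eq
  ... | nothing = ⊥-elim (minList-≢nothing (∈-costs⁺ F⊑E sub) eq)
  ... | just c with minList-just (costs S) eq
  ... | c∈ , c≤costs with ∈-costs⁻ c∈
  ... | _ , _ , F′⊑E , sub′ , refl =
    ≤-antisym (≤-trans (All.lookup c≤costs (∈-costs⁺ F⊑E sub)) F≤m) (lower F′⊑E sub′)

  leaf? : Fin n → Bool
  leaf? v = degree G v ≡ᵇ 1

  pendent-edge : Fin n × Fin n → Bool
  pendent-edge e = leaf? (proj₁ e) ∨ leaf? (proj₂ e)

  leaf?-≡1 : ∀ {v} → degree G v ≡ 1 → leaf? v ≡ true
  leaf?-≡1 = cong (_≡ᵇ 1)

  leaf?-≥2 : ∀ {v} → 2 ≤ degree G v → leaf? v ≡ false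
  leaf?-≥2 {v} 2≤d with degree G v | 2≤d
  ... | suc (suc _) | _       = refl
  ... | suc zero    | s≤s ()

  leaf-neighbour : ∀ {v a b} → degree G v ≡ 1 → Adj G v a → Adj G v b → a ≡ b
  leaf-neighbour {a = a} {b} d≡1 ra rb with a ≟ b
  ... | yes a≡b = a≡b
  ... | no  a≢b with subst (2 ≤_) d≡1 (degree-≥2 a≢b ra rb)
  ...   | s≤s ()

  interior-degree : ∀ {x y v} (p : Star (Adj G) x y) → Unique (vertices p) → v ∈ vertices p →
                    v ≢ x → v ≢ y → 2 ≤ degree G v
  interior-degree p up v∈p v≢x v≢y with interior p up v∈p v≢x v≢y
  ... | _ , _ , c≢d , cv , vd = degree-≥2 c≢d (Adj-sym cv) vd

  simple-path-cycle : ∀ {R : Fin n → Fin n → Set} → (∀ {x y} → R x y → Adj G x y) →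
                      ∀ {a b} (p : Star R a b) → Unique (vertices p) → 2 ≤ steps p → Adj G b a → HasCycle G
  simple-path-cycle f {a} p@(_ ◅ q) up 2≤steps ba =
    a , vertices q , s≤s (subst (2 ≤_) (sym (length-vertices q)) 2≤steps) , up , linked-vertices f p ba

  Touches : Fin n → Fin n × Fin n → Set
  Touches v e = proj₁ e ≡ v ⊎ proj₂ e ≡ v

  touches? : ∀ v → Decidable (Touches v)
  touches? v e = (proj₁ e ≟ v) ⊎-dec (proj₂ e ≟ v)

  incident avoiding : Fin n → List (Fin n × Fin n)
  incident v = filter (touches? v) (edges G)
  avoiding v = filter (∁? (touches? v)) (edges G)

  other-endpoint : Fin n → Fin n × Fin n → Fin n
  other-endpoint v (a , b) with a ≟ v
  ... | yes _ = b
  ... | no  _ = a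

  degree≤incident : ∀ v → degree G v ≤ length (incident v)
  degree≤incident v = begin
    degree G v                                   ≤⟨ length-mono-⊆ (neighbours-unique v) neighbours⊆ ⟩
    length (map (other-endpoint v) (incident v)) ≡⟨ length-map _ (incident v) ⟩
    length (incident v)                          ∎
    where
    open ≤-Reasoning
    via : ∀ {e a} → e ∈ edges G → Touches v e → other-endpoint v e ≡ a → a ∈ map (other-endpoint v) (incident v)
    via e∈E touches refl = ∈-map⁺ (other-endpoint v) (∈-filter⁺ (touches? v) e∈E touches)
    neighbours⊆ : neighbours v ⊆ map (other-endpoint v) (incident v)
    neighbours⊆ {a} a∈ with Adj⇒Link (Equivalence.to T-≡ (proj₂ (∈-filter⁻ (λ x → T? (adj G v x)) {xs = allFin n} a∈)))
    ... | inj₁ va∈E = via va∈E (inj₁ refl) (other-start v a)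
      where
      other-start : ∀ v a → other-endpoint v (v , a) ≡ a
      other-start v a with v ≟ v
      ... | yes _   = refl
      ... | no  v≢v = ⊥-elim (v≢v refl)
    ... | inj₂ av∈E = via av∈E (inj₂ refl) (other-end (Adj⇒≢ (proj₂ (∈-edges⁻ av∈E))))
      where
      other-end : ∀ {a v} → a ≢ v → other-endpoint v (a , v) ≡ a
      other-end {a} {v} a≢v with a ≟ v
      ... | yes a≡v = ⊥-elim (a≢v a≡v)
      ... | no  _   = refl

  count-n∸1 : ∀ {u v} (_⊲_ : ℕ → ℕ → Bool) → u ≢ v →
              count (λ S → steiner G (S ∪ ⁅ u ⁆) ⊲ steiner G (S ∪ ⁅ v ⁆)) (candidates (n ∸ 1) u v)
              ≡ indicator (steiner G (∁ ⁅ v ⁆) ⊲ steiner G (∁ ⁅ u ⁆))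
  count-n∸1 {u} {v} _⊲_ u≢v = begin
    count (λ S → steiner G (S ∪ ⁅ u ⁆) ⊲ steiner G (S ∪ ⁅ v ⁆)) (candidates (n ∸ 1) u v)
      ≡⟨ cong (count _) (candidates-n∸1 u≢v) ⟩
    count (λ S → steiner G (S ∪ ⁅ u ⁆) ⊲ steiner G (S ∪ ⁅ v ⁆)) [ without u v ]
      ≡⟨ count-[ (λ S → steiner G (S ∪ ⁅ u ⁆) ⊲ steiner G (S ∪ ⁅ v ⁆)) ] (without u v) ⟩
    indicator (steiner G (without u v ∪ ⁅ u ⁆) ⊲ steiner G (without u v ∪ ⁅ v ⁆))
      ≡⟨ cong₂ (λ S S′ → indicator (steiner G S ⊲ steiner G S′)) (without∪⁅⁆ u≢v) without∪⁅v⁆ ⟩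
    indicator (steiner G (∁ ⁅ v ⁆) ⊲ steiner G (∁ ⁅ u ⁆))
      ∎
    where
    open ≡-Reasoning
    without∪⁅v⁆ : without u v ∪ ⁅ v ⁆ ≡ ∁ ⁅ u ⁆
    without∪⁅v⁆ = trans (cong (_∪ ⁅ v ⁆) (without-comm u v)) (without∪⁅⁆ (u≢v ∘ sym))

  nU-n∸1 : ∀ {u v} → u ≢ v → nU G (n ∸ 1) u v ≡ indicator (steiner G (∁ ⁅ v ⁆) <ᵇ steiner G (∁ ⁅ u ⁆))
  nU-n∸1 = count-n∸1 _<ᵇ_

  nV-n∸1 : ∀ {u v} → u ≢ v → nV G (n ∸ 1) u v ≡ indicator (steiner G (∁ ⁅ u ⁆) <ᵇ steiner G (∁ ⁅ v ⁆))
  nV-n∸1 u≢v = count-n∸1 _<ᵇ_ (u≢v ∘ sym)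

  n0-n∸1 : ∀ {u v} → u ≢ v → n0 G (n ∸ 1) u v ≡ indicator (steiner G (∁ ⁅ v ⁆) ≡ᵇ steiner G (∁ ⁅ u ⁆))
  n0-n∸1 = count-n∸1 _≡ᵇ_

-- Trees

module Tree {n : ℕ} (G : Graph n) (tree : IsTree G) where
  open GraphProperties G

  path : ∀ u v → Star (Adj G) u v
  path u v = walk⇒path (proj₁ tree u v)
    where
    walk⇒path : ∀ {u v} → Walk G u v → Star (Adj G) u v
    walk⇒path here       = ε
    walk⇒path (step r w) = r ◅ walk⇒path w

  reach-edges : ∀ x y → T (reach (edges G) x y)
  reach-edges x y = let (p , up) = shortcut _≟_ (Star.map Adj⇒Link (path x y))
                    in Reach.simple-path⇒reach (edges G) p up

  module _ (u : Fin n) where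
    open Reach.Parents (edges G) u

    n∸1≤edges : n ∸ 1 ≤ length (edges G)
    n∸1≤edges = begin
      n ∸ 1                  ≡⟨ sym (length-except {K = [ u ]} ([] ∷ [])) ⟩
      length (except [ u ])  ≤⟨ length≤length-edges (except-unique [ u ]) reachable ⟩
      length (edges G)       ∎
      where
      open ≤-Reasoning
      reachable : ∀ {w} → w ∈ except [ u ] → w ≢ u × T (reach (edges G) u w)
      reachable w∈ = (λ w≡u → ∈-except⁻ w∈ (here w≡u)) , reach-edges u _

    parents⊆edges : parents ⊆ edges G
    parents⊆edges e∈ with ∈-map⁻ parent e∈
    ... | w , w∈ , refl =
      proj₁ (proj₂ (parent-first-entry (λ w≡u → ∈-except⁻ w∈ (here w≡u)) (reach-edges u w)))

    -- an edge that is not a parent edge would close a cycle with the parent paths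
    edges⊆parents : edges G ⊆ parents
    edges⊆parents {a , b} ab∈E with Any.any? ((a , b) ≟ₑ_) parents
    ... | yes ab∈P = ab∈P
    ... | no  ab∉P = ⊥-elim (proj₂ tree (simple-path-cycle (Link⇒Adj ∘ Link-mono F′⊆E) q uq
                       (two-steps q (Adj⇒≢ ab) ¬a—b) (Adj-sym ab)))
      where
      a<b = proj₁ (∈-edges⁻ ab∈E)
      ab  = proj₂ (∈-edges⁻ ab∈E)
      F′ = filter (λ e → ¬? (e ≟ₑ (a , b))) (edges G)
      F′⊆E : F′ ⊆ edges G
      F′⊆E = proj₁ ∘ ∈-filter⁻ (λ e → ¬? (e ≟ₑ (a , b)))
      parents⊆F′ : parents ⊆ F′
      parents⊆F′ e∈ = ∈-filter⁺ (λ e → ¬? (e ≟ₑ (a , b))) (parents⊆edges e∈) λ { refl → ab∉P e∈ }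
      ¬a—b : ¬ Link F′ a b
      ¬a—b (inj₁ ab∈F′) = proj₂ (∈-filter⁻ (λ e → ¬? (e ≟ₑ (a , b))) {xs = edges G} ab∈F′) refl
      ¬a—b (inj₂ ba∈F′) = <-asym a<b (proj₁ (∈-edges⁻ (F′⊆E ba∈F′)))
      from-root : ∀ x → Star (Link F′) u x
      from-root x = Star.map (Link-mono parents⊆F′) (parent-path n (reach-edges u x))
      q  = proj₁ (shortcut _≟_ (Star.reverse Link-sym (from-root a) ◅◅ from-root b))
      uq = proj₂ (shortcut _≟_ (Star.reverse Link-sym (from-root a) ◅◅ from-root b))

    edges≤n∸1 : length (edges G) ≤ n ∸ 1
    edges≤n∸1 = begin
      length (edges G)      ≤⟨ length-mono-⊆ edges-unique edges⊆parents ⟩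
      length parents        ≡⟨ length-map parent (except [ u ]) ⟩
      length (except [ u ]) ≡⟨ length-except {K = [ u ]} ([] ∷ []) ⟩
      n ∸ 1                 ∎
      where open ≤-Reasoning

  edge-count : Fin n → length (edges G) ≡ n ∸ 1
  edge-count u = ≤-antisym (edges≤n∸1 u) (n∸1≤edges u)

  module _ (3≤n : 3 ≤ n) where

    third : ∀ u v → ∃[ w ] (w ≢ u × w ≢ v)
    third u v with fresh {K = u ∷ v ∷ []} 3≤n
    ... | w , w∉ = w , w∉ ∘ here , w∉ ∘ there ∘ here

    leaf-or-branch : ∀ v → degree G v ≡ 1 ⊎ 2 ≤ degree G v
    leaf-or-branch v with third v v
    ... | w , w≢v , _ with path v w
    ...   | ε     = ⊥-elim (w≢v refl)
    ...   | r ◅ _ with degree G v | degree-≥1 r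
    ...     | suc zero    | _ = inj₁ refl
    ...     | suc (suc _) | _ = inj₂ (s≤s (s≤s z≤n))

    no-leaf-edge : ∀ {u v} → Adj G u v → degree G u ≡ 1 → degree G v ≡ 1 → ⊥
    no-leaf-edge {u} {v} uv du dv with third u v
    ... | w , w≢u , w≢v with shortcut _≟_ (path u w)
    ...   | ε , _ = w≢u refl
    ...   | r ◅ q , up with subst (2 ≤_) dv (interior-degree (r ◅ q) up v∈ (Adj⇒≢ uv ∘ sym) (w≢v ∘ sym))
      where v∈ = there (subst (_∈ vertices q) (leaf-neighbour du r uv) (start∈vertices q))
    ...     | s≤s ()

    ∁⁅⁆-subgraph-size : ∀ {v W F} → SteinerSubgraph (∁ ⁅ v ⁆) W F → n ∸ 2 ≤ length F
    ∁⁅⁆-subgraph-size {v} {W} {F} sub with third v v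
    ... | u , u≢v , _ = begin
      n ∸ 2                        ≡⟨ sym (length-except ((u≢v ∷ []) ∷ [] ∷ [])) ⟩
      length (except (u ∷ v ∷ [])) ≤⟨ SteinerSubgraph-size sub (S⊆W (∈-∁⁅⁆ u≢v)) (except-unique _) in-W ⟩
      length F                     ∎
      where
      open ≤-Reasoning
      open SteinerSubgraph sub
      in-W : ∀ {w} → w ∈ except (u ∷ v ∷ []) → w ≢ u × w ∈ₛ W
      in-W w∈ = ∈-except⁻ w∈ ∘ here , S⊆W (∈-∁⁅⁆ (∈-except⁻ w∈ ∘ there ∘ here))

    avoiding-length : ∀ {v k} → k ≤ degree G v → length (avoiding v) ≤ n ∸ 1 ∸ k
    avoiding-length {v} {k} k≤d = begin
      length (avoiding v)
        ≡⟨ sym (m+n∸m≡n (length (incident v)) _) ⟩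
      length (incident v) + length (avoiding v) ∸ length (incident v)
        ≡⟨ cong (_∸ length (incident v)) (length-filter-∁ (touches? v) (edges G)) ⟩
      length (edges G) ∸ length (incident v)
        ≤⟨ ∸-monoʳ-≤ (length (edges G)) (≤-trans k≤d (degree≤incident v)) ⟩
      length (edges G) ∸ k
        ≡⟨ cong (_∸ k) (edge-count v) ⟩
      n ∸ 1 ∸ k
        ∎
      where open ≤-Reasoning

    steiner-leaf : ∀ {v} → degree G v ≡ 1 → steiner G (∁ ⁅ v ⁆) ≡ n ∸ 2
    steiner-leaf {v} d≡1 = steiner-≡ (λ _ → ∁⁅⁆-subgraph-size)
      (∁ ⁅ v ⁆ , avoiding v , Sublist.filter-⊆ (∁? (touches? v)) (edges G) , subgraph ,
       subst (length (avoiding v) ≤_) (∸-+-assoc n 1 1) (avoiding-length (≤-reflexive (sym d≡1))))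
      where
      outside-v : ∀ {x y} → x ≢ v → y ≢ v → Adj G x y → Link (avoiding v) x y
      outside-v x≢v y≢v r with Adj⇒Link r
      ... | inj₁ xy∈E = inj₁ (∈-filter⁺ (∁? (touches? v)) xy∈E [ x≢v , y≢v ]′)
      ... | inj₂ yx∈E = inj₂ (∈-filter⁺ (∁? (touches? v)) yx∈E [ y≢v , x≢v ]′)
      -- a simple path between two other vertices cannot pass through the leaf v
      connected : ∀ {x y} → x ∈ₛ ∁ ⁅ v ⁆ → y ∈ₛ ∁ ⁅ v ⁆ → T (reach (avoiding v) x y)
      connected {x} {y} x∈ y∈ with shortcut _≟_ (path x y)
      ... | p , up with map-within outside-v p (All.tabulate avoids-v)
        where
        avoids-v : ∀ {w} → w ∈ vertices p → w ≢ v
        avoids-v w∈p refl with subst (2 ≤_) d≡1 (interior-degree p up w∈p (∈-∁⁅⁆⁻ x∈ ∘ sym) (∈-∁⁅⁆⁻ y∈ ∘ sym))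
        ... | s≤s ()
      ... | q , q≡p = Reach.simple-path⇒reach (avoiding v) q (subst Unique (sym q≡p) up)
      subgraph : SteinerSubgraph (∁ ⁅ v ⁆) (∁ ⁅ v ⁆) (avoiding v)
      subgraph = record
        { S⊆W         = λ i∈ → i∈
        ; F⊆W         = λ ab∈ → let ¬touches = proj₂ (∈-filter⁻ (∁? (touches? v)) {xs = edges G} ab∈)
                                 in ∈-∁⁅⁆ (¬touches ∘ inj₁) , ∈-∁⁅⁆ (¬touches ∘ inj₂)
        ; W-connected = connected
        }

    steiner-branch : ∀ {v} → 2 ≤ degree G v → steiner G (∁ ⁅ v ⁆) ≡ n ∸ 1
    steiner-branch {v} 2≤d = steiner-≡ lower
      (⊤ , edges G , Sublist.⊆-refl , whole , ≤-reflexive (edge-count v))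
      where
      whole : SteinerSubgraph (∁ ⁅ v ⁆) ⊤ (edges G)
      whole = record { S⊆W = λ _ → ∈⊤ ; F⊆W = λ _ → ∈⊤ , ∈⊤ ; W-connected = λ _ _ → reach-edges _ _ }
      lower : ∀ {W F} → F ⊑ edges G → SteinerSubgraph (∁ ⁅ v ⁆) W F → n ∸ 1 ≤ length F
      lower {W} {F} F⊑E sub with v ∈ₛ? W | third v v
      ... | yes v∈W | u , u≢v , _ = begin
        n ∸ 1                 ≡⟨ sym (length-except {K = [ u ]} ([] ∷ [])) ⟩
        length (except [ u ]) ≤⟨ SteinerSubgraph-size sub (S⊆W (∈-∁⁅⁆ u≢v)) (except-unique _) in-W ⟩
        length F              ∎
        where
        open ≤-Reasoning
        open SteinerSubgraph sub
        in-W : ∀ {w} → w ∈ except [ u ] → w ≢ u × w ∈ₛ W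
        in-W {w} w∈ with w ≟ v
        ... | yes refl = ∈-except⁻ w∈ ∘ here , v∈W
        ... | no  w≢v  = ∈-except⁻ w∈ ∘ here , S⊆W (∈-∁⁅⁆ w≢v)
      -- without v the subgraph misses both edges at v, leaving too few edges
      ... | no v∉W | _ = ⊥-elim (n∸2≰n∸3 n 3≤n (≤-trans (∁⁅⁆-subgraph-size sub) (begin
        length F              ≤⟨ length-mono-⊆ (Unique-⊑ F⊑E edges-unique) F⊆avoiding ⟩
        length (avoiding v)   ≤⟨ avoiding-length 2≤d ⟩
        n ∸ 1 ∸ 2             ∎)))
        where
        open ≤-Reasoning
        open SteinerSubgraph sub
        F⊆avoiding : F ⊆ avoiding v
        F⊆avoiding ab∈F = ∈-filter⁺ (∁? (touches? v)) (⊑⇒⊆ F⊑E ab∈F)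
          [ (λ { refl → v∉W (proj₁ (F⊆W ab∈F)) }) , (λ { refl → v∉W (proj₂ (F⊆W ab∈F)) }) ]′

    steiner-∁⁅⁆ : ∀ v → steiner G (∁ ⁅ v ⁆) ≡ n ∸ 2 + indicator (not (leaf? v))
    steiner-∁⁅⁆ v with leaf-or-branch v
    ... | inj₁ d≡1 = begin
      steiner G (∁ ⁅ v ⁆)                ≡⟨ steiner-leaf d≡1 ⟩
      n ∸ 2                              ≡⟨ +-identityʳ (n ∸ 2) ⟨
      n ∸ 2 + indicator (not true)       ≡⟨ cong (λ b → n ∸ 2 + indicator (not b)) (leaf?-≡1 d≡1) ⟨
      n ∸ 2 + indicator (not (leaf? v))  ∎
      where open ≡-Reasoning
    ... | inj₂ 2≤d = begin
      steiner G (∁ ⁅ v ⁆)                ≡⟨ steiner-branch 2≤d ⟩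
      n ∸ 1                              ≡⟨ ∸1≡∸2+1 n (≤-trans (n≤1+n 2) 3≤n) ⟩
      n ∸ 2 + indicator (not false)      ≡⟨ cong (λ b → n ∸ 2 + indicator (not b)) (leaf?-≥2 2≤d) ⟨
      n ∸ 2 + indicator (not (leaf? v))  ∎
      where open ≡-Reasoning

-- Edge contributions

data EdgeProfile : ℕ → ℕ → ℕ → Bool → Set where
  inner : EdgeProfile 0 0 1 false
  leafˡ : EdgeProfile 0 1 0 true
  leafʳ : EdgeProfile 1 0 0 true

-- N + [not leaf] is the Steiner distance of the complement of a vertex; stated with N first
-- so that the comparisons below reduce by recursion on N
distance-profile : ∀ N ℓu ℓv → ¬ (T ℓu × T ℓv) →
                   let su = N + indicator (not ℓu)
                       sv = N + indicator (not ℓv)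
                   in EdgeProfile (indicator (sv <ᵇ su)) (indicator (su <ᵇ sv)) (indicator (sv ≡ᵇ su)) (ℓu ∨ ℓv)
distance-profile zero    true  true  ¬both = ⊥-elim (¬both (_ , _))
distance-profile zero    true  false _     = leafˡ
distance-profile zero    false true  _     = leafʳ
distance-profile zero    false false _     = inner
distance-profile (suc N) ℓu    ℓv    ¬both = distance-profile N ℓu ℓv ¬both

Sz-term : ∀ {nu nv n₀ p} → EdgeProfile nu nv n₀ p → (nu + 1) * (nv + 1) ≡ (if p then 2 else 1)
Sz-term inner = refl
Sz-term leafˡ = refl
Sz-term leafʳ = refl

rSz-term : ∀ {nu nv n₀ p} → EdgeProfile nu nv n₀ p →
           (ℕ→ℚ nu +ℚ (+ n₀ / 2) +ℚ ℕ→ℚ 1) *ℚ (ℕ→ℚ nv +ℚ (+ n₀ / 2) +ℚ ℕ→ℚ 1) ≡ (if p then ℕ→ℚ 2 else + 9 / 4)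
rSz-term inner = refl
rSz-term leafˡ = refl
rSz-term leafʳ = refl

sum-2-or-1 : ∀ (g : A → ℕ) (p : A → Bool) xs → (∀ {x} → x ∈ xs → g x ≡ (if p x then 2 else 1)) →
             foldr _+_ 0 (map g xs) ≡ length xs + count p xs
sum-2-or-1 g p []       _  = refl
sum-2-or-1 g p (x ∷ xs) g≡ rewrite g≡ (here refl) | sum-2-or-1 g p xs (g≡ ∘ there) with p x
... | true  = cong suc (sym (+-suc (length xs) (count p xs)))
... | false = refl

sum-a-or-b : ∀ (g : A → ℚ) (p : A → Bool) (a b : ℚ) xs → (∀ {x} → x ∈ xs → g x ≡ (if p x then a else b)) →
             foldr _+ℚ_ 0ℚ (map g xs) ≡ a *ℚ ℕ→ℚ (count p xs) +ℚ b *ℚ (ℕ→ℚ (length xs) - ℕ→ℚ (count p xs))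
sum-a-or-b g p a b []       _  = solve 2 (λ a b → con 0ℚ := a :* con 0ℚ :+ b :* (con 0ℚ :- con 0ℚ)) refl a b
  where open +-*-Solver
sum-a-or-b g p a b (x ∷ xs) g≡ rewrite g≡ (here refl) | sum-a-or-b g p a b xs (g≡ ∘ there)
                                     | ℕ→ℚ-suc (length xs) with p x
... | true  rewrite ℕ→ℚ-suc (count p xs) =
  solve 4 (λ a b c l → a :+ (a :* c :+ b :* (l :- c)) := a :* (c :+ con 1ℚ) :+ b :* ((l :+ con 1ℚ) :- (c :+ con 1ℚ)))
          refl a b (ℕ→ℚ (count p xs)) (ℕ→ℚ (length xs))
  where open +-*-Solver
... | false =
  solve 4 (λ a b c l → b :+ (a :* c :+ b :* (l :- c)) := a :* c :+ b :* ((l :+ con 1ℚ) :- c))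
          refl a b (ℕ→ℚ (count p xs)) (ℕ→ℚ (length xs))
  where open +-*-Solver

module _ {n : ℕ} {G : Graph n} (tree : IsTree G) (3≤n : 3 ≤ n) where
  open GraphProperties G
  open Tree G tree

  edge-profile : ∀ {u v} → Adj G u v →
                 EdgeProfile (nU G (n ∸ 1) u v) (nV G (n ∸ 1) u v) (n0 G (n ∸ 1) u v) (leaf? u ∨ leaf? v)
  edge-profile {u} {v} uv rewrite nU-n∸1 (Adj⇒≢ uv) | nV-n∸1 (Adj⇒≢ uv) | n0-n∸1 (Adj⇒≢ uv)
                                | steiner-∁⁅⁆ 3≤n u | steiner-∁⁅⁆ 3≤n v =
    distance-profile (n ∸ 2) (leaf? u) (leaf? v)
      λ (ℓu , ℓv) → no-leaf-edge 3≤n uv (≡ᵇ⇒≡ _ 1 ℓu) (≡ᵇ⇒≡ _ 1 ℓv)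

  Sz-n∸1 : Sz (n ∸ 1) G ≡ length (edges G) + pendent G
  Sz-n∸1 = sum-2-or-1 _ pendent-edge (edges G) λ e∈E → Sz-term (edge-profile (proj₂ (∈-edges⁻ e∈E)))

  rSz-n∸1 : rSz (n ∸ 1) G ≡
            ℕ→ℚ 2 *ℚ ℕ→ℚ (pendent G) +ℚ (+ 9 / 4) *ℚ (ℕ→ℚ (length (edges G)) - ℕ→ℚ (pendent G))
  rSz-n∸1 = sum-a-or-b _ pendent-edge (ℕ→ℚ 2) (+ 9 / 4) (edges G)
              λ e∈E → rSz-term (edge-profile (proj₂ (∈-edges⁻ e∈E)))

theorem4p1 : (n : ℕ) (T : Graph n) → 3 ≤ n → IsTree T →
    (Sz (n ∸ 1) T ≡ n + pendent T ∸ 1)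
    × (rSz (n ∸ 1) T ≡ ℕ→ℚ 2 *ℚ ℕ→ℚ (pendent T)
         +ℚ (+ 9 / 4) *ℚ (ℕ→ℚ n - ℕ→ℚ (pendent T) - ℕ→ℚ 1))
theorem4p1 n G 3≤n tree =
  ( begin
      Sz (n ∸ 1) G          ≡⟨ Sz-n∸1 tree 3≤n ⟩
      length (edges G) + p  ≡⟨ cong (_+ p) |E| ⟩
      n ∸ 1 + p             ≡⟨ +-∸-comm p 1≤n ⟨
      n + p ∸ 1             ∎ )
  , ( begin
      rSz (n ∸ 1) G
        ≡⟨ rSz-n∸1 tree 3≤n ⟩
      ℕ→ℚ 2 *ℚ ℕ→ℚ p +ℚ (+ 9 / 4) *ℚ (ℕ→ℚ (length (edges G)) - ℕ→ℚ p)
        ≡⟨ cong (λ m → ℕ→ℚ 2 *ℚ ℕ→ℚ p +ℚ (+ 9 / 4) *ℚ (ℕ→ℚ m - ℕ→ℚ p)) |E| ⟩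
      ℕ→ℚ 2 *ℚ ℕ→ℚ p +ℚ (+ 9 / 4) *ℚ (ℕ→ℚ (n ∸ 1) - ℕ→ℚ p)
        ≡⟨ cong (λ d → ℕ→ℚ 2 *ℚ ℕ→ℚ p +ℚ (+ 9 / 4) *ℚ d) (ℕ→ℚ-∸1 (ℕ→ℚ p) 1≤n) ⟩
      ℕ→ℚ 2 *ℚ ℕ→ℚ p +ℚ (+ 9 / 4) *ℚ (ℕ→ℚ n - ℕ→ℚ p - ℕ→ℚ 1)
        ∎ )
  where
  open ≡-Reasoning
  p = pendent G
  1≤n : 1 ≤ n
  1≤n = ≤-trans (s≤s z≤n) 3≤n
  |E| : length (edges G) ≡ n ∸ 1
  |E| = Tree.edge-count G tree (fromℕ< 1≤n)
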